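{- Let $f\colon\{0,1\}^n\to\{0,1\}$ satisfy $\mathrm{dist}(f,\text{$k$-Junta})=\varepsilon<\frac12$. Then $g\colon\{0,1\}^n\times\{0,1\}\to\{0,1\}$ defined by $g(x,y)=f(x)\oplus y$ satisfies $\mathrm{dist}(g,\text{$(k+1)$-Junta})=\varepsilon$.
   Context: A $k$-junta is a function depending on at most $k$ of its variables. $\mathrm{dist}(f,h)=\Pr_{\boldsymbol x}[f(\boldsymbol x)\ne h(\boldsymbol x)]$ for uniform $\boldsymbol x$, and $\mathrm{dist}(f,\text{$k$-Junta})$ is the minimum of $\mathrm{dist}(f,h)$ over $k$-juntas $h$ on the same domain. -}

module Defs where

open import Data.Nat using (ℕ; zero; suc; _+_; _^_; _≤_)
open import Data.Nat.Properties using (m^n≢0)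
open import Data.Bool using (Bool; true; false; _xor_; if_then_else_)
open import Data.Fin using (Fin; zero; suc)
open import Data.Fin.Subset using (Subset; _∈_; ∣_∣)
open import Data.List using (List; []; _∷_; _++_; map)
open import Data.Nat.ListAction using (sum)
open import Data.Integer using (+_)
open import Data.Rational using (ℚ; _/_)
open import Data.Product using (Σ; _×_)
open import Relation.Binary.PropositionalEquality using (_≡_)

Cube : ℕ → Set
Cube n = Fin n → Bool

BoolFun : ℕ → Set
BoolFun n = Cube n → Bool

cons : ∀ {n} → Bool → Cube n → Cube (suc n)
cons b x zero    = b
cons b x (suc i) = x i

allPoints : (n : ℕ) → List (Cube n)
allPoints zero    = (λ ()) ∷ []
allPoints (suc n) = map (cons false) (allPoints n) ++ map (cons true) (allPoints n)

disagreements : ∀ {n} → BoolFun n → BoolFun n → ℕ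
disagreements {n} f h = sum (map (λ x → if f x xor h x then 1 else 0) (allPoints n))

dist : ∀ {n} → BoolFun n → BoolFun n → ℚ
dist {n} f h = (+ disagreements f h) / (2 ^ n)
  where instance _ = m^n≢0 2 n

IsJunta : ∀ {n} → ℕ → BoolFun n → Set
IsJunta {n} k h =
  Σ (Subset n) λ S → (∣ S ∣ ≤ k) ×
    ((x y : Cube n) → ((i : Fin n) → i ∈ S → x i ≡ y i) → h x ≡ h y)

DistToJuntas≡ : ∀ {n} → BoolFun n → ℕ → ℚ → Set
DistToJuntas≡ {n} f k ε =
  (Σ (BoolFun n) λ h → IsJunta k h × (dist f h ≡ ε)) ×
  ((h : BoolFun n) → IsJunta k h → ε Data.Rational.≤ dist f h)

-- g(x,y) = f(x) ⊕ y, with y stored in coordinate 0 of {0,1}^(n+1)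
xorExtend : ∀ {n} → BoolFun n → BoolFun (suc n)
xorExtend f z = f (λ i → z (suc i)) xor z zero

-- Split a candidate (k+1)-junta H on {0,1}^(n+1) into its slices H₀ = H(·,0) and
-- H₁ = ¬H(·,1); then dist(g,H) is the average of dist(f,H₀) and dist(f,H₁). If y is a
-- relevant variable of H, both slices are k-juntas, so the average is at least ε.
-- Otherwise H₁ = ¬H₀, the two disagreement counts sum to 2^n and dist(g,H) = ½, which
-- is the average of the distances from f to the two constant k-juntas. The junta
-- h ⊕ y, for h a closest k-junta to f, attains ε.
module Submission where

open import Defs

open import Data.Bool using (Bool; true; false; not; _xor_; if_then_else_)
open import Data.Bool.Properties using (xor-identityʳ; xor-assoc; not-distribʳ-xor)
open import Data.Fin using (zero; suc)
open import Data.Fin.Subset using (⊥)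
open import Data.Fin.Subset.Properties using (∣⊥∣≡0)
import Data.Integer as ℤ
import Data.Integer.Properties as ℤ
open import Data.List using ([]; _∷_; _++_; map)
open import Data.List.Properties using (map-++; map-∘; map-cong)
open import Data.Nat as ℕ using (ℕ; suc; NonZero; _+_; _^_; s≤s; z≤n)
import Data.Nat.Properties as ℕ
open import Algebra.Properties.CommutativeSemigroup ℕ.+-commutativeSemigroup using (interchange)
open import Data.Nat.ListAction using (sum)
open import Data.Nat.ListAction.Properties using (sum-++)
open import Data.Product using (_,_)
open import Data.Rational using (ℚ; _/_; _≤_; _<_; ½)
open import Data.Rational.Properties using (toℚᵘ-cancel-≤; toℚᵘ-fromℚᵘ; fromℚᵘ-cong; ≤-trans; module ≤-Reasoning)
open import Data.Rational.Unnormalised using (mkℚᵘ; *≤*; *≡*)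
import Data.Rational.Unnormalised.Properties as ℚᵘ
open import Data.Sum using (_⊎_; inj₁; inj₂)
open import Data.Vec.Base using (_∷_; here; there)
open import Function using (_∘_)
open import Relation.Binary.PropositionalEquality

-- i / suc d is definitionally fromℚᵘ (mkℚᵘ i d), so both lemmas reduce to ℚᵘ.
/-monoˡ-≤ : ∀ {i j} d .{{_ : NonZero d}} → i ℤ.≤ j → i / d ≤ j / d
/-monoˡ-≤ {i} {j} (suc d) i≤j = toℚᵘ-cancel-≤
  (ℚᵘ.≤-respˡ-≃ (ℚᵘ.≃-sym (toℚᵘ-fromℚᵘ (mkℚᵘ i d)))
    (ℚᵘ.≤-respʳ-≃ (ℚᵘ.≃-sym (toℚᵘ-fromℚᵘ (mkℚᵘ j d)))
      (*≤* (ℤ.*-monoʳ-≤-nonNeg (ℤ.+ suc d) i≤j))))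

/-cancelˡ : ∀ c a d .{{_ : NonZero c}} .{{_ : NonZero d}} →
            (ℤ.+ (c ℕ.* a) / (c ℕ.* d)) {{ℕ.m*n≢0 c d}} ≡ ℤ.+ a / d
/-cancelˡ c@(suc c-1) a d@(suc d-1) =
  fromℚᵘ-cong {mkℚᵘ (ℤ.+ (c ℕ.* a)) (d-1 + c-1 ℕ.* d)} {mkℚᵘ (ℤ.+ a) d-1} (*≡* (begin
  ℤ.+ (c ℕ.* a) ℤ.* ℤ.+ d ≡⟨ ℤ.pos-* (c ℕ.* a) d ⟨
  ℤ.+ (c ℕ.* a ℕ.* d)     ≡⟨ cong ℤ.+_ (ℕ.*-assoc c a d) ⟩
  ℤ.+ (c ℕ.* (a ℕ.* d))   ≡⟨ cong ℤ.+_ (cong (c ℕ.*_) (ℕ.*-comm a d)) ⟩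
  ℤ.+ (c ℕ.* (d ℕ.* a))   ≡⟨ cong ℤ.+_ (ℕ.*-assoc c d a) ⟨
  ℤ.+ (c ℕ.* d ℕ.* a)     ≡⟨ cong ℤ.+_ (ℕ.*-comm (c ℕ.* d) a) ⟩
  ℤ.+ (a ℕ.* (c ℕ.* d))   ≡⟨ ℤ.pos-* a (c ℕ.* d) ⟩
  ℤ.+ a ℤ.* ℤ.+ (c ℕ.* d) ∎))
  where open ≡-Reasoning

≤-/-average : ∀ {q} a b d .{{_ : NonZero d}} → q ≤ ℤ.+ a / d → q ≤ ℤ.+ b / d →
              q ≤ (ℤ.+ (a + b) / (2 ℕ.* d)) {{ℕ.m*n≢0 2 d}}
≤-/-average {q} a b d q≤a q≤b = ≤-trans q≤a⊓b (begin
  ℤ.+ (a ℕ.⊓ b) / d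
    ≡⟨ /-cancelˡ 2 (a ℕ.⊓ b) d ⟨
  (ℤ.+ (2 ℕ.* (a ℕ.⊓ b)) / (2 ℕ.* d)) {{ℕ.m*n≢0 2 d}}
    ≤⟨ /-monoˡ-≤ (2 ℕ.* d) {{ℕ.m*n≢0 2 d}} (ℤ.+≤+ twice-min≤sum) ⟩
  (ℤ.+ (a + b) / (2 ℕ.* d)) {{ℕ.m*n≢0 2 d}} ∎)
  where
  open ≤-Reasoning
  q≤a⊓b : q ≤ ℤ.+ (a ℕ.⊓ b) / d
  q≤a⊓b with ℕ.⊓-sel a b
  ... | inj₁ a⊓b≡a = subst (λ m → q ≤ ℤ.+ m / d) (sym a⊓b≡a) q≤a
  ... | inj₂ a⊓b≡b = subst (λ m → q ≤ ℤ.+ m / d) (sym a⊓b≡b) q≤b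
  twice-min≤sum : 2 ℕ.* (a ℕ.⊓ b) ℕ.≤ a + b
  twice-min≤sum = subst (ℕ._≤ a + b) (cong (a ℕ.⊓ b ℕ.+_) (sym (ℕ.+-identityʳ _)))
    (ℕ.+-mono-≤ (ℕ.m⊓n≤m a b) (ℕ.m⊓n≤n a b))

indicator : Bool → ℕ
indicator b = if b then 1 else 0

sum-map-+ : ∀ {A : Set} (φ ψ : A → ℕ) xs →
            sum (map (λ x → φ x + ψ x) xs) ≡ sum (map φ xs) + sum (map ψ xs)
sum-map-+ φ ψ []       = refl
sum-map-+ φ ψ (x ∷ xs) = trans (cong ((φ x + ψ x) +_) (sum-map-+ φ ψ xs))
                               (interchange (φ x) (ψ x) _ _)

sum-map-allPoints-suc : ∀ n (φ : Cube (suc n) → ℕ) →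
  sum (map φ (allPoints (suc n))) ≡
  sum (map (φ ∘ cons false) (allPoints n)) + sum (map (φ ∘ cons true) (allPoints n))
sum-map-allPoints-suc n φ = begin
  sum (map φ (map (cons false) xs ++ map (cons true) xs))
    ≡⟨ cong sum (map-++ φ (map (cons false) xs) (map (cons true) xs)) ⟩
  sum (map φ (map (cons false) xs) ++ map φ (map (cons true) xs))
    ≡⟨ sum-++ (map φ (map (cons false) xs)) _ ⟩
  sum (map φ (map (cons false) xs)) + sum (map φ (map (cons true) xs))
    ≡⟨ cong₂ _+_ (cong sum (map-∘ xs)) (cong sum (map-∘ xs)) ⟨
  sum (map (φ ∘ cons false) xs) + sum (map (φ ∘ cons true) xs) ∎
  where open ≡-Reasoning
        xs = allPoints n

disagreements-cong : ∀ {n} (f : BoolFun n) {h h′ : BoolFun n} → (∀ x → h x ≡ h′ x) →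
                     disagreements f h ≡ disagreements f h′
disagreements-cong {n} f h≗h′ =
  cong sum (map-cong (λ x → cong (λ b → indicator (f x xor b)) (h≗h′ x)) (allPoints n))

sum-map-1-allPoints : ∀ n → sum (map (λ _ → 1) (allPoints n)) ≡ 2 ^ n
sum-map-1-allPoints ℕ.zero    = refl
sum-map-1-allPoints (suc n) = begin
  sum (map (λ _ → 1) (allPoints (suc n)))
    ≡⟨ sum-map-allPoints-suc n (λ _ → 1) ⟩
  sum (map (λ _ → 1) (allPoints n)) + sum (map (λ _ → 1) (allPoints n))
    ≡⟨ cong₂ _+_ (sum-map-1-allPoints n) (sum-map-1-allPoints n) ⟩
  2 ^ n + 2 ^ n
    ≡⟨ cong (2 ^ n +_) (ℕ.+-identityʳ (2 ^ n)) ⟨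
  2 ^ n + (2 ^ n + 0) ∎
  where open ≡-Reasoning

disagreements-complement : ∀ {n} (f h : BoolFun n) →
  disagreements f h + disagreements f (not ∘ h) ≡ 2 ^ n
disagreements-complement {n} f h = begin
  disagreements f h + disagreements f (not ∘ h)   ≡⟨ sum-map-+ _ _ (allPoints n) ⟨
  sum (map (λ x → indicator (f x xor h x) + indicator (f x xor not (h x))) (allPoints n))
    ≡⟨ cong sum (map-cong (λ x → indicator-xor-complement (f x) (h x)) (allPoints n)) ⟩
  sum (map (λ _ → 1) (allPoints n))              ≡⟨ sum-map-1-allPoints n ⟩
  2 ^ n                                          ∎
  where
  open ≡-Reasoning
  indicator-xor-complement : ∀ a b → indicator (a xor b) + indicator (a xor not b) ≡ 1
  indicator-xor-complement a b rewrite sym (not-distribʳ-xor a b) with a xor b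
  ... | true  = refl
  ... | false = refl

disagreements-xorExtend : ∀ {n} (f : BoolFun n) (H : BoolFun (suc n)) →
  disagreements (xorExtend f) H ≡
  disagreements f (H ∘ cons false) + disagreements f (not ∘ H ∘ cons true)
disagreements-xorExtend {n} f H = trans (sum-map-allPoints-suc n _)
  (cong₂ _+_ (cong sum (map-cong slice-false (allPoints n)))
             (cong sum (map-cong slice-true (allPoints n))))
  where
  slice-false : ∀ x → indicator ((f x xor false) xor H (cons false x)) ≡ indicator (f x xor H (cons false x))
  slice-false x = cong (λ b → indicator (b xor H (cons false x))) (xor-identityʳ (f x))
  slice-true : ∀ x → indicator ((f x xor true) xor H (cons true x)) ≡ indicator (f x xor not (H (cons true x)))
  slice-true x = cong indicator (xor-assoc (f x) true (H (cons true x)))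

disagreements-xorExtend-xorExtend : ∀ {n} (f h : BoolFun n) →
  disagreements (xorExtend f) (xorExtend h) ≡ 2 ℕ.* disagreements f h
disagreements-xorExtend-xorExtend f h = begin
  disagreements (xorExtend f) (xorExtend h)
    ≡⟨ disagreements-xorExtend f (xorExtend h) ⟩
  disagreements f (λ x → h x xor false) + disagreements f (λ x → not (h x xor true))
    ≡⟨ cong₂ _+_ (disagreements-cong f (λ x → xor-identityʳ (h x)))
                 (disagreements-cong f (λ x → trans (not-distribʳ-xor (h x) true) (xor-identityʳ (h x)))) ⟩
  disagreements f h + disagreements f h
    ≡⟨ cong (disagreements f h +_) (ℕ.+-identityʳ _) ⟨
  2 ℕ.* disagreements f h ∎
  where open ≡-Reasoning

const-isJunta : ∀ {n} k (b : Bool) → IsJunta k (λ (_ : Cube n) → b)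
const-isJunta {n} k b = ⊥ , subst (ℕ._≤ k) (sym (∣⊥∣≡0 n)) z≤n , λ _ _ _ → refl

∘-isJunta : ∀ {n k} (φ : Bool → Bool) {h : BoolFun n} → IsJunta k h → IsJunta k (φ ∘ h)
∘-isJunta φ (S , ∣S∣≤k , h-on-S) = S , ∣S∣≤k , λ x y x≈y → cong φ (h-on-S x y x≈y)

xorExtend-isJunta : ∀ {n k} {h : BoolFun n} → IsJunta k h → IsJunta (suc k) (xorExtend h)
xorExtend-isJunta (S , ∣S∣≤k , h-on-S) = true ∷ S , s≤s ∣S∣≤k ,
  λ x y x≈y → cong₂ _xor_ (h-on-S _ _ (λ i i∈S → x≈y (suc i) (there i∈S))) (x≈y zero here)

isJunta-slices : ∀ {n k} {H : BoolFun (suc n)} → IsJunta (suc k) H →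
  (∀ x → H (cons true x) ≡ H (cons false x)) ⊎ (∀ b → IsJunta k (H ∘ cons b))
isJunta-slices (false ∷ S , _ , H-on-S) =
  inj₁ λ x → H-on-S _ _ λ { zero () ; (suc i) _ → refl }
isJunta-slices (true ∷ S , s≤s ∣S∣≤k , H-on-S) =
  inj₂ λ b → S , ∣S∣≤k , λ x y x≈y → H-on-S _ _ λ { zero _ → refl ; (suc i) (there i∈S) → x≈y i i∈S }

dist-xorExtend-xorExtend : ∀ {n} (f h : BoolFun n) → dist (xorExtend f) (xorExtend h) ≡ dist f h
dist-xorExtend-xorExtend {n} f h = trans
  (cong (λ d → ℤ.+ d / 2 ^ suc n) (disagreements-xorExtend-xorExtend f h))
  (/-cancelˡ 2 (disagreements f h) (2 ^ n))
  where instance _ = ℕ.m^n≢0 2 n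
                 _ = ℕ.m^n≢0 2 (suc n)

dist-xorExtend-lowerBound : ∀ {n k} (f : BoolFun n) {ε : ℚ} →
  (∀ h → IsJunta k h → ε ≤ dist f h) →
  ∀ H → IsJunta (suc k) H → ε ≤ dist (xorExtend f) H
dist-xorExtend-lowerBound {n} {k} f {ε} ε≤dist H H-junta =
  subst (λ d → ε ≤ ℤ.+ d / 2 ^ suc n) (sym (disagreements-xorExtend f H)) (bound (isJunta-slices H-junta))
  where
  instance _ = ℕ.m^n≢0 2 n
           _ = ℕ.m^n≢0 2 (suc n)
  H₀ H₁ : BoolFun n
  H₀ = H ∘ cons false
  H₁ = not ∘ H ∘ cons true
  bound : (∀ x → H (cons true x) ≡ H (cons false x)) ⊎ (∀ b → IsJunta k (H ∘ cons b)) →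
          ε ≤ ℤ.+ (disagreements f H₀ + disagreements f H₁) / 2 ^ suc n
  bound (inj₂ slices) = ≤-/-average (disagreements f H₀) (disagreements f H₁) (2 ^ n)
    (ε≤dist H₀ (slices false)) (ε≤dist H₁ (∘-isJunta not (slices true)))
  bound (inj₁ H₀≗H₁) = subst (λ d → ε ≤ ℤ.+ d / 2 ^ suc n) constants≡slices
    (≤-/-average (disagreements f (λ _ → false)) (disagreements f (λ _ → true)) (2 ^ n)
      (ε≤dist _ (const-isJunta k false)) (ε≤dist _ (const-isJunta k true)))
    where
    constants≡slices : disagreements f (λ _ → false) + disagreements f (λ _ → true) ≡
                       disagreements f H₀ + disagreements f H₁
    constants≡slices = begin
      disagreements f (λ _ → false) + disagreements f (λ _ → true) ≡⟨ disagreements-complement f _ ⟩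
      2 ^ n                                                        ≡⟨ disagreements-complement f H₀ ⟨
      disagreements f H₀ + disagreements f (not ∘ H₀)
        ≡⟨ cong (disagreements f H₀ +_) (disagreements-cong f (λ x → cong not (sym (H₀≗H₁ x)))) ⟩
      disagreements f H₀ + disagreements f H₁                      ∎
      where open ≡-Reasoning

claimB1 : (n k : ℕ) (f : BoolFun n) (ε : ℚ) →
    DistToJuntas≡ f k ε → ε < ½ →
    DistToJuntas≡ (xorExtend f) (suc k) ε
claimB1 n k f ε ((h , h-junta , dist-f-h≡ε) , ε≤dist) _ =
  (xorExtend h , xorExtend-isJunta h-junta , trans (dist-xorExtend-xorExtend f h) dist-f-h≡ε) ,
  dist-xorExtend-lowerBound f ε≤dist
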